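{- Let $\mathbb{F}_q$ be a finite field and let $b\in\mathbb{F}_q^\times$ be such that the multiplicative order of $-b$ is not a prime power (i.e. it is divisible by at least two distinct primes). Then there exists $a\in\mathbb{F}_q^\times$ such that, for $Q=\begin{pmatrix} a & b\\ 1 & 0\end{pmatrix}$, the group $G=\langle Q\rangle$ acting on $\mathbb{F}_q\times\mathbb{F}_q$ has non-trivial orbits of three different lengths.
   Context: $G=\langle Q\rangle$ acts on $\mathbb{F}_q\times\mathbb{F}_q$ (column vectors) by $v\mapsto Q^nv$; orbit length is the number of elements of the orbit; non-trivial orbits are orbits of non-zero vectors. -}

module Defs where

open import Level using (Level; _⊔_) renaming (suc to lsuc)
open import Algebra.Bundles using (CommutativeRing)
open import Data.Nat using (ℕ; zero; suc; _≤_) renaming (_^_ to _^ℕ_)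
open import Data.Nat.Primality using (Prime)
open import Data.Fin using (Fin)
open import Data.Product using (Σ; ∃; ∃-syntax; _×_; _,_)
open import Data.List using (List; length)
open import Data.List.Relation.Unary.All using (All)
open import Data.List.Relation.Unary.Any using (Any)
open import Data.List.Relation.Unary.AllPairs using (AllPairs)
open import Relation.Binary.PropositionalEquality using (_≡_)
open import Relation.Nullary using (¬_)

record FiniteField (c ℓ : Level) : Set (lsuc (c ⊔ ℓ)) where
  field
    commRing : CommutativeRing c ℓ
  open CommutativeRing commRing public
  field
    0≉1     : 0# ≉ 1#
    inverse : ∀ x → x ≉ 0# → ∃[ y ] (x * y ≈ 1#)
    size    : ℕ
    enum    : Fin size → Carrier
    index   : Carrier → Fin size
    enum-index    : ∀ x → enum (index x) ≈ x
    index-enum    : ∀ i → index (enum i) ≡ i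
    index-cong    : ∀ {x y} → x ≈ y → index x ≡ index y

IsPrimePower : ℕ → Set
IsPrimePower k = ∃[ p ] ∃[ e ] (Prime p × k ≡ p ^ℕ e)

module _ {c ℓ : Level} (F : FiniteField c ℓ) where
  open FiniteField F

  pow : Carrier → ℕ → Carrier
  pow x zero    = 1#
  pow x (suc n) = x * pow x n

  IsMultOrder : Carrier → ℕ → Set ℓ
  IsMultOrder x k =
    (1 ≤ k) × (pow x k ≈ 1#) × (∀ j → 1 ≤ j → pow x j ≈ 1# → k ≤ j)

  Vec2 : Set c
  Vec2 = Carrier × Carrier

  _≈v_ : Vec2 → Vec2 → Set ℓ
  (x₁ , y₁) ≈v (x₂ , y₂) = (x₁ ≈ x₂) × (y₁ ≈ y₂)

  zeroV : Vec2
  zeroV = 0# , 0#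

  -- 2×2 matrices  ((m₁₁ , m₁₂) , (m₂₁ , m₂₂))  (rows)
  Mat2 : Set c
  Mat2 = Vec2 × Vec2

  _·_ : Mat2 → Vec2 → Vec2
  ((m₁₁ , m₁₂) , (m₂₁ , m₂₂)) · (x , y) = (m₁₁ * x + m₁₂ * y) , (m₂₁ * x + m₂₂ * y)

  Qmat : Carrier → Carrier → Mat2
  Qmat a b = (a , b) , (1# , 0#)

  powAct : Mat2 → ℕ → Vec2 → Vec2
  powAct M zero    v = v
  powAct M (suc n) v = M · powAct M n v

  -- w lies in the orbit of v under ⟨M⟩ (M of finite order, so ⟨M⟩ = {M^n : n ∈ ℕ})
  InOrbit : Mat2 → Vec2 → Vec2 → Set ℓ
  InOrbit M v w = ∃[ n ] (w ≈v powAct M n v)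

  OrbitLength : Mat2 → Vec2 → ℕ → Set (c ⊔ ℓ)
  OrbitLength M v m = ∃[ ws ]
    ( (length ws ≡ m)
    × AllPairs (λ w w′ → ¬ (w ≈v w′)) ws
    × All (InOrbit M v) ws
    × (∀ w → InOrbit M v w → Any (w ≈v_) ws))

-- Factor k = r s with r, s ≥ 2 coprime (r the full power of a prime dividing k). By Bézout,
-- −b = α β with αʳ = βˢ = 1, and since −b has order r s, α and β have orders exactly r and s.
-- Put a = α + β: then α and β are the roots of X² − aX − b, so (α , 1) and (β , 1) are
-- eigenvectors of Q with orbit lengths r and s, while their sum has orbit length r s, because
-- α ≠ β makes the two eigencomponents of Qⁿ (α + β , 2) independent. Finally a ≠ 0, for
-- otherwise α² = β², which forces r, s ≤ 2 and hence r = s.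

module Submission where

open import Defs
open import Data.Nat using (ℕ)
open import Data.Product using (∃-syntax; _×_)
open import Relation.Binary.PropositionalEquality using (_≢_)
open import Relation.Nullary using (¬_)

open import Level using (_⊔_)
import Data.Nat as ℕ
import Data.Nat.Properties as ℕ
open import Data.Nat using (zero; suc; _≤_; _<_; s≤s; z≤n; _∸_)
open import Data.Nat.DivMod using (_%_; _/_; m≡m%n+[m/n]*n; m%n<n)
open import Data.Nat.Coprimality using (Coprime; coprime-Bézout)
open import Data.Nat.GCD using (module Bézout)
open import Data.Nat.Tactic.RingSolver using (solve-∀)
open import Data.List using (applyUpTo)
open import Data.List.Properties using (length-applyUpTo)
import Data.List.Relation.Unary.All.Properties as All
import Data.List.Relation.Unary.Any.Properties as Any
import Data.List.Relation.Unary.AllPairs.Properties as AllPairs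
open import Data.Maybe using (nothing)
open import Data.Product using (_,_; proj₁; proj₂)
open import Data.Product.Relation.Binary.Pointwise.NonDependent using (×-setoid)
open import Relation.Binary.Bundles using (Setoid)
open import Relation.Binary.PropositionalEquality as ≡ using (_≡_)

module Arithmetic where
  open import Data.Nat
  open import Data.Nat.Properties
  open import Data.Nat.Divisibility
  open import Data.Nat.Primality
  open import Data.Nat.Primality.Factorisation using (factorise)
  open import Data.Nat.Induction using (<-rec)
  open import Data.List using ([]; _∷_)
  open import Data.Nat.ListAction using (product)
  open import Data.List.Relation.Unary.All using (_∷_)
  open import Data.Sum using (inj₁; inj₂)
  open import Relation.Nullary using (yes; no; contradiction)
  open import Relation.Binary.PropositionalEquality

  ≢0∧≢1⇒≥2 : ∀ {n} → n ≢ 0 → n ≢ 1 → 2 ≤ n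
  ≢0∧≢1⇒≥2 {0}           n≢0 _   = contradiction refl n≢0
  ≢0∧≢1⇒≥2 {1}           _   n≢1 = contradiction refl n≢1
  ≢0∧≢1⇒≥2 {suc (suc _)} _   _   = s≤s (s≤s z≤n)

  prime⇒≥2 : ∀ {p} → Prime p → 2 ≤ p
  prime⇒≥2 {p} p-prime = nonTrivial⇒n>1 p {{prime⇒nonTrivial p-prime}}

  ∃prime∣ : ∀ {n} → 2 ≤ n → ∃[ p ] (Prime p × p ∣ n)
  ∃prime∣ {n@(suc _)} 2≤n with factorise n
  ... | record { factors = [] ; isFactorisation = n≡1 } = contradiction (sym n≡1) (<⇒≢ 2≤n)
  ... | record { factors = p ∷ ps ; isFactorisation = n≡∏ ; factorsPrime = p-prime ∷ _ } =
    p , p-prime , subst (p ∣_) (sym n≡∏) (m∣m*n (product ps))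

  prime∣^⇒≡ : ∀ {q p} e → Prime q → Prime p → q ∣ p ^ e → q ≡ p
  prime∣^⇒≡ zero q-prime _ q∣1 = contradiction (subst Prime (∣1⇒≡1 q∣1) q-prime) ¬prime[1]
  prime∣^⇒≡ {q} {p} (suc e) q-prime p-prime q∣p^1+e with euclidsLemma p (p ^ e) q-prime q∣p^1+e
  ... | inj₂ q∣p^e = prime∣^⇒≡ e q-prime p-prime q∣p^e
  ... | inj₁ q∣p with prime⇒irreducible p-prime q∣p
  ...   | inj₁ q≡1 = contradiction (subst Prime q≡1 q-prime) ¬prime[1]
  ...   | inj₂ q≡p = q≡p

  FactorsOut : ℕ → ℕ → Set
  FactorsOut p n = ∃[ e ] ∃[ m ] (n ≡ p ^ e * m × ¬ p ∣ m)

  factorOut : ∀ {p} → Prime p → ∀ n → 1 ≤ n → FactorsOut p n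
  factorOut {p} p-prime = <-rec (λ n → 1 ≤ n → FactorsOut p n) go
    where
    go : ∀ n → (∀ {n′} → n′ < n → 1 ≤ n′ → FactorsOut p n′) → 1 ≤ n → FactorsOut p n
    go n rec 1≤n with p ∣? n
    ... | no p∤n = 0 , n , sym (+-identityʳ n) , p∤n
    ... | yes (divides q n≡q*p) =
      let e , m , q≡pᵉm , p∤m = rec q<n 1≤q in
      suc e , m , trans n≡q*p (trans (cong (_* p) q≡pᵉm) (pᵉm*p≡p*pᵉ*m e m)) , p∤m
      where
      1≤q : 1 ≤ q
      1≤q = n≢0⇒n>0 λ { refl → <⇒≢ 1≤n (sym n≡q*p) }
      q<n : q < n
      q<n = subst (q <_) (sym n≡q*p) (m<m*n q p {{>-nonZero 1≤q}} (prime⇒≥2 p-prime))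
      pᵉm*p≡p*pᵉ*m : ∀ e m → p ^ e * m * p ≡ p * p ^ e * m
      pᵉm*p≡p*pᵉ*m e m = trans (*-comm (p ^ e * m) p) (sym (*-assoc p (p ^ e) m))

  prime^-coprime : ∀ {p m} e → Prime p → ¬ p ∣ m → Coprime (p ^ e) m
  prime^-coprime {p} {m} e p-prime p∤m {i} (i∣p^e , i∣m) with i ≟ 1
  ... | yes i≡1 = i≡1
  ... | no i≢1 with ∃prime∣ (≢0∧≢1⇒≥2 (λ { refl → p∤m (subst (p ∣_) (sym (0∣⇒≡0 i∣m)) (p ∣0)) }) i≢1)
  ...   | q , q-prime , q∣i =
    contradiction (subst (_∣ m) (prime∣^⇒≡ e q-prime p-prime (∣-trans q∣i i∣p^e)) (∣-trans q∣i i∣m)) p∤m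

  record CoprimeFactorisation (k : ℕ) : Set where
    field
      r s     : ℕ
      r*s≡k   : r * s ≡ k
      2≤r     : 2 ≤ r
      2≤s     : 2 ≤ s
      coprime : Coprime r s

    1≤r : 1 ≤ r
    1≤r = <⇒≤ 2≤r

    1≤s : 1 ≤ s
    1≤s = <⇒≤ 2≤s

    r≢s : r ≢ s
    r≢s r≡s = <⇒≢ 2≤r (sym (coprime (∣-refl , subst (r ∣_) r≡s ∣-refl)))

    r≢r*s : r ≢ r * s
    r≢r*s = <⇒≢ (m<m*n r s {{>-nonZero 1≤r}} 2≤s)

    s≢r*s : s ≢ r * s
    s≢r*s = <⇒≢ (subst (s <_) (*-comm s r) (m<m*n s r {{>-nonZero 1≤s}} 2≤r))

  ¬primePower⇒≥2 : ∀ {k} → 1 ≤ k → ¬ IsPrimePower k → 2 ≤ k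
  ¬primePower⇒≥2 1≤k ¬pp = ≢0∧≢1⇒≥2 (m<n⇒n≢0 1≤k) λ { refl → ¬pp (2 , 0 , prime[2] , refl) }

  ¬primePower⇒coprimeFactorisation : ∀ {k} → 1 ≤ k → ¬ IsPrimePower k → CoprimeFactorisation k
  ¬primePower⇒coprimeFactorisation {k} 1≤k ¬pp with ∃prime∣ (¬primePower⇒≥2 1≤k ¬pp)
  ... | p , p-prime , p∣k with factorOut p-prime k 1≤k
  ...   | zero , m , k≡m+0 , p∤m = contradiction (subst (p ∣_) (trans k≡m+0 (+-identityʳ m)) p∣k) p∤m
  ...   | suc e , m , k≡pᵉm , p∤m = record
    { r       = p ^ suc e
    ; s       = m
    ; r*s≡k   = sym k≡pᵉm
    ; 2≤r     = ≤-trans (prime⇒≥2 p-prime) (m≤m*n p (p ^ e) {{m^n≢0 p e {{prime⇒nonZero p-prime}}}})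
    ; 2≤s     = ≢0∧≢1⇒≥2 (λ { refl → p∤m (p ∣0) })
                         (λ { refl → ¬pp (p , suc e , p-prime , trans k≡pᵉm (*-identityʳ _)) })
    ; coprime = prime^-coprime (suc e) p-prime p∤m
    }

open Arithmetic using (CoprimeFactorisation; ¬primePower⇒coprimeFactorisation)

module Properties {c ℓ} (F : FiniteField c ℓ) where
  open FiniteField F
  open import Relation.Binary.Reasoning.Setoid setoid
  open import Algebra.Solver.Ring.NaturalCoefficients commutativeSemiring (λ _ _ → nothing)
  open import Algebra.Properties.Ring ring using (+-cancelˡ; +-cancelʳ; x∙y⁻¹≈ε⇒x≈y)
  import Algebra.Properties.CommutativeSemiring.Exp commutativeSemiring as Exp

  -- Powers and multiplicative orders

  infixr 8 _^_
  _^_ : Carrier → ℕ → Carrier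
  x ^ n = pow F x n

  ^≈Exp^ : ∀ x n → x ^ n ≈ x Exp.^ n
  ^≈Exp^ x zero    = refl
  ^≈Exp^ x (suc n) = *-cong refl (^≈Exp^ x n)

  ^-cong : ∀ {x y} n → x ≈ y → x ^ n ≈ y ^ n
  ^-cong {x} {y} n x≈y = trans (^≈Exp^ x n) (trans (Exp.^-congˡ n x≈y) (sym (^≈Exp^ y n)))

  ^-homo-* : ∀ x m n → x ^ (m ℕ.+ n) ≈ x ^ m * x ^ n
  ^-homo-* x m n = trans (^≈Exp^ x (m ℕ.+ n))
    (trans (Exp.^-homo-* x m n) (sym (*-cong (^≈Exp^ x m) (^≈Exp^ x n))))

  ^-assocʳ : ∀ x m n → (x ^ m) ^ n ≈ x ^ (m ℕ.* n)
  ^-assocʳ x m n = trans (^≈Exp^ (x ^ m) n)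
    (trans (Exp.^-congˡ n (^≈Exp^ x m)) (trans (Exp.^-assocʳ x m n) (sym (^≈Exp^ x (m ℕ.* n)))))

  ^-distrib-* : ∀ x y n → (x * y) ^ n ≈ x ^ n * y ^ n
  ^-distrib-* x y n = trans (^≈Exp^ (x * y) n)
    (trans (Exp.^-distrib-* x y n) (sym (*-cong (^≈Exp^ x n) (^≈Exp^ y n))))

  1^n≈1 : ∀ n → 1# ^ n ≈ 1#
  1^n≈1 zero    = refl
  1^n≈1 (suc n) = trans (*-identityˡ _) (1^n≈1 n)

  x^m≈1⇒x^[m*n]≈1 : ∀ x m n → x ^ m ≈ 1# → x ^ (m ℕ.* n) ≈ 1#
  x^m≈1⇒x^[m*n]≈1 x m n x^m≈1 = trans (sym (^-assocʳ x m n)) (trans (^-cong n x^m≈1) (1^n≈1 n))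

  *-cancelˡ-≉0 : ∀ {z x y} → z ≉ 0# → z * x ≈ z * y → x ≈ y
  *-cancelˡ-≉0 {z} {x} {y} z≉0 zx≈zy with inverse z z≉0
  ... | w , zw≈1 = begin
    x             ≈⟨ *-identityˡ x ⟨
    1# * x        ≈⟨ *-cong zw≈1 refl ⟨
    (z * w) * x   ≈⟨ solve 3 (λ z w x → (z :* w) :* x := w :* (z :* x)) refl z w x ⟩
    w * (z * x)   ≈⟨ *-cong refl zx≈zy ⟩
    w * (z * y)   ≈⟨ solve 3 (λ z w y → w :* (z :* y) := (z :* w) :* y) refl z w y ⟩
    (z * w) * y   ≈⟨ *-cong zw≈1 refl ⟩
    1# * y        ≈⟨ *-identityˡ y ⟩
    y             ∎

  x^n≉0 : ∀ {x} n → x ≉ 0# → x ^ n ≉ 0#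
  x^n≉0 zero      _   1≈0     = 0≉1 (sym 1≈0)
  x^n≉0 {x} (suc n) x≉0 x*xⁿ≈0 = x^n≉0 n x≉0 (*-cancelˡ-≉0 x≉0 (trans x*xⁿ≈0 (sym (zeroʳ x))))

  x^n≈1⇒x≉0 : ∀ {x} n → 1 ≤ n → x ^ n ≈ 1# → x ≉ 0#
  x^n≈1⇒x≉0 {x} (suc n) _ xⁿ≈1 x≈0 = 0≉1 (begin
    0#          ≈⟨ zeroˡ (x ^ n) ⟨
    0# * x ^ n  ≈⟨ *-cong x≈0 refl ⟨
    x ^ suc n   ≈⟨ xⁿ≈1 ⟩
    1#          ∎)

  x^i≈x^[d+i]⇒x^d≈1 : ∀ {x} i d → x ≉ 0# → x ^ i ≈ x ^ (d ℕ.+ i) → x ^ d ≈ 1#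
  x^i≈x^[d+i]⇒x^d≈1 {x} i d x≉0 xⁱ≈xᵈ⁺ⁱ = sym (*-cancelˡ-≉0 (x^n≉0 i x≉0) (begin
    x ^ i * 1#     ≈⟨ *-identityʳ _ ⟩
    x ^ i          ≈⟨ xⁱ≈xᵈ⁺ⁱ ⟩
    x ^ (d ℕ.+ i)  ≈⟨ ^-homo-* x d i ⟩
    x ^ d * x ^ i  ≈⟨ *-comm _ _ ⟩
    x ^ i * x ^ d  ∎))

  x^[2*n]≈[x*x]^n : ∀ x n → x ^ (2 ℕ.* n) ≈ (x * x) ^ n
  x^[2*n]≈[x*x]^n x n = trans (sym (^-assocʳ x 2 n)) (^-cong n (*-cong refl (*-identityʳ x)))

  x+y≈0⇒x*x≈y*y : ∀ {x y} → x + y ≈ 0# → x * x ≈ y * y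
  x+y≈0⇒x*x≈y*y {x} {y} x+y≈0 = +-cancelʳ (x * y) (x * x) (y * y) (begin
    x * x + x * y  ≈⟨ distribˡ x x y ⟨
    x * (x + y)    ≈⟨ *-cong refl x+y≈0 ⟩
    x * 0#         ≈⟨ zeroʳ x ⟩
    0#             ≈⟨ zeroʳ y ⟨
    y * 0#         ≈⟨ *-cong refl x+y≈0 ⟨
    y * (x + y)    ≈⟨ solve 2 (λ x y → y :* (x :+ y) := y :* y :+ x :* y) refl x y ⟩
    y * y + x * y  ∎)

  IsJointOrder : Carrier → Carrier → ℕ → Set ℓ
  IsJointOrder x y N =
    (1 ≤ N) × (x ^ N ≈ 1#) × (y ^ N ≈ 1#) × (∀ d → 1 ≤ d → x ^ d ≈ 1# → y ^ d ≈ 1# → N ≤ d)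

  isJointOrder-comm : ∀ {x y} r s → IsJointOrder x y (r ℕ.* s) → IsJointOrder y x (s ℕ.* r)
  isJointOrder-comm r s (1≤N , xᴺ≈1 , yᴺ≈1 , least) = ≡.subst (IsJointOrder _ _) (ℕ.*-comm r s)
    (1≤N , yᴺ≈1 , xᴺ≈1 , λ d 1≤d yᵈ≈1 xᵈ≈1 → least d 1≤d xᵈ≈1 yᵈ≈1)

  isMultOrder-unique : ∀ {x y m n} → x ≈ y → IsMultOrder F x m → IsMultOrder F y n → m ≡ n
  isMultOrder-unique {m = m} {n} x≈y (1≤m , xᵐ≈1 , leastₓ) (1≤n , yⁿ≈1 , leastᵧ) =
    ℕ.≤-antisym (leastₓ n 1≤n (trans (^-cong n x≈y) yⁿ≈1)) (leastᵧ m 1≤m (trans (^-cong m (sym x≈y)) xᵐ≈1))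

  record Splitting (g : Carrier) (r s : ℕ) : Set (c ⊔ ℓ) where
    field
      α β   : Carrier
      α*β≈g : α * β ≈ g
      αʳ≈1  : α ^ r ≈ 1#
      βˢ≈1  : β ^ s ≈ 1#

  splitting-comm : ∀ {g r s} → Splitting g r s → Splitting g s r
  splitting-comm σ = record { α = β ; β = α ; α*β≈g = trans (*-comm β α) α*β≈g ; αʳ≈1 = βˢ≈1 ; βˢ≈1 = αʳ≈1 }
    where open Splitting σ

  splitting⇒isJointOrder : ∀ {g r s} → IsMultOrder F g (r ℕ.* s) → (σ : Splitting g r s) →
    IsJointOrder (Splitting.α σ) (Splitting.β σ) (r ℕ.* s)
  splitting⇒isJointOrder {g} {r} {s} (1≤rs , _ , least) σ =
    1≤rs , x^m≈1⇒x^[m*n]≈1 α r s αʳ≈1 ,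
    ≡.subst (λ n → β ^ n ≈ 1#) (ℕ.*-comm s r) (x^m≈1⇒x^[m*n]≈1 β s r βˢ≈1) ,
    λ d 1≤d αᵈ≈1 βᵈ≈1 → least d 1≤d (begin
      g ^ d          ≈⟨ ^-cong d α*β≈g ⟨
      (α * β) ^ d    ≈⟨ ^-distrib-* α β d ⟩
      α ^ d * β ^ d  ≈⟨ *-cong αᵈ≈1 βᵈ≈1 ⟩
      1# * 1#        ≈⟨ *-identityˡ 1# ⟩
      1#             ∎)
    where open Splitting σ

  isJointOrder⇒isMultOrder : ∀ {α β r s} → IsJointOrder α β (r ℕ.* s) → 1 ≤ r → 1 ≤ s →
    α ^ r ≈ 1# → β ^ s ≈ 1# → IsMultOrder F α r
  isJointOrder⇒isMultOrder {α} {β} {r} {s} (_ , _ , _ , least) 1≤r 1≤s αʳ≈1 βˢ≈1 =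
    1≤r , αʳ≈1 , λ d 1≤d αᵈ≈1 → ℕ.*-cancelʳ-≤ r d s {{ℕ.>-nonZero 1≤s}}
      (least (d ℕ.* s) (ℕ.*-mono-≤ 1≤d 1≤s) (x^m≈1⇒x^[m*n]≈1 α d s αᵈ≈1)
        (≡.subst (λ n → β ^ n ≈ 1#) (ℕ.*-comm s d) (x^m≈1⇒x^[m*n]≈1 β s d βˢ≈1)))

  equalSquares⇒≤2 : ∀ {α β r s} → IsJointOrder α β (r ℕ.* s) → 1 ≤ s → β ^ s ≈ 1# →
    α * α ≈ β * β → r ≤ 2
  equalSquares⇒≤2 {α} {β} {r} {s} (_ , _ , _ , least) 1≤s βˢ≈1 α²≈β² =
    ℕ.*-cancelʳ-≤ r 2 s {{ℕ.>-nonZero 1≤s}} (least (2 ℕ.* s) (ℕ.*-mono-≤ {1} {2} (s≤s z≤n) 1≤s) α²ˢ≈1 β²ˢ≈1)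
    where
    β²ˢ≈1 : β ^ (2 ℕ.* s) ≈ 1#
    β²ˢ≈1 = ≡.subst (λ n → β ^ n ≈ 1#) (ℕ.*-comm s 2) (x^m≈1⇒x^[m*n]≈1 β s 2 βˢ≈1)
    α²ˢ≈1 : α ^ (2 ℕ.* s) ≈ 1#
    α²ˢ≈1 = begin
      α ^ (2 ℕ.* s)  ≈⟨ x^[2*n]≈[x*x]^n α s ⟩
      (α * α) ^ s    ≈⟨ ^-cong s α²≈β² ⟩
      (β * β) ^ s    ≈⟨ x^[2*n]≈[x*x]^n β s ⟨
      β ^ (2 ℕ.* s)  ≈⟨ β²ˢ≈1 ⟩
      1#             ∎

  jointOrder-sum≉0 : ∀ {α β r s} → IsJointOrder α β (r ℕ.* s) → α ^ r ≈ 1# → β ^ s ≈ 1# →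
    2 ≤ r → 2 ≤ s → r ≢ s → α + β ≉ 0#
  jointOrder-sum≉0 {α} {β} {r} {s} joint αʳ≈1 βˢ≈1 2≤r 2≤s r≢s α+β≈0 =
    r≢s (≡.trans (ℕ.≤-antisym r≤2 2≤r) (≡.sym (ℕ.≤-antisym s≤2 2≤s)))
    where
    α²≈β² : α * α ≈ β * β
    α²≈β² = x+y≈0⇒x*x≈y*y α+β≈0
    r≤2 : r ≤ 2
    r≤2 = equalSquares⇒≤2 joint (ℕ.<⇒≤ 2≤s) βˢ≈1 α²≈β²
    s≤2 : s ≤ 2
    s≤2 = equalSquares⇒≤2 (isJointOrder-comm r s joint) (ℕ.<⇒≤ 2≤r) αʳ≈1 (sym α²≈β²)

  -- α = g^(−y s) is written with the non-negative exponent y s r, as g^(y s (r + 1)) = 1.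
  bézout⇒splitting : ∀ {g} r s x y → g ^ (suc r ℕ.* s) ≈ 1# → 1 ℕ.+ y ℕ.* s ≡ x ℕ.* suc r →
    Splitting g (suc r) s
  bézout⇒splitting {g} r s x y gᵏ≈1 bézout = record
    { α     = g ^ (y ℕ.* s ℕ.* r)
    ; β     = g ^ (x ℕ.* suc r)
    ; α*β≈g = begin
        g ^ (y ℕ.* s ℕ.* r) * g ^ (x ℕ.* suc r)  ≈⟨ ^-homo-* g (y ℕ.* s ℕ.* r) (x ℕ.* suc r) ⟨
        g ^ (y ℕ.* s ℕ.* r ℕ.+ x ℕ.* suc r)      ≡⟨ ≡.cong (g ^_) α*β-exponent ⟩
        g * g ^ (suc r ℕ.* s ℕ.* y)              ≈⟨ *-cong refl (x^m≈1⇒x^[m*n]≈1 g (suc r ℕ.* s) y gᵏ≈1) ⟩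
        g * 1#                                   ≈⟨ *-identityʳ g ⟩
        g                                        ∎
    ; αʳ≈1  = trans (^-assocʳ g (y ℕ.* s ℕ.* r) (suc r))
                (≡.subst (λ n → g ^ n ≈ 1#) (≡.sym (αʳ-exponent y s r)) (x^m≈1⇒x^[m*n]≈1 g (suc r ℕ.* s) (y ℕ.* r) gᵏ≈1))
    ; βˢ≈1  = trans (^-assocʳ g (x ℕ.* suc r) s)
                (≡.subst (λ n → g ^ n ≈ 1#) (≡.sym (βˢ-exponent x s r)) (x^m≈1⇒x^[m*n]≈1 g (suc r ℕ.* s) x gᵏ≈1))
    }
    where
    α*β-exponent-regroup : ∀ y s r → y ℕ.* s ℕ.* r ℕ.+ (1 ℕ.+ y ℕ.* s) ≡ 1 ℕ.+ suc r ℕ.* s ℕ.* y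
    α*β-exponent-regroup = solve-∀
    α*β-exponent : y ℕ.* s ℕ.* r ℕ.+ x ℕ.* suc r ≡ 1 ℕ.+ suc r ℕ.* s ℕ.* y
    α*β-exponent = ≡.trans (≡.cong (y ℕ.* s ℕ.* r ℕ.+_) (≡.sym bézout)) (α*β-exponent-regroup y s r)
    αʳ-exponent : ∀ y s r → y ℕ.* s ℕ.* r ℕ.* suc r ≡ suc r ℕ.* s ℕ.* (y ℕ.* r)
    αʳ-exponent = solve-∀
    βˢ-exponent : ∀ x s r → x ℕ.* suc r ℕ.* s ≡ suc r ℕ.* s ℕ.* x
    βˢ-exponent = solve-∀

  coprime⇒splitting : ∀ {g r s} → g ^ (r ℕ.* s) ≈ 1# → 1 ≤ r → 1 ≤ s → Coprime r s → Splitting g r s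
  coprime⇒splitting {g} {suc r} {suc s} gʳˢ≈1 (s≤s z≤n) (s≤s z≤n) coprime with coprime-Bézout coprime
  ... | Bézout.+- x y eq = bézout⇒splitting r (suc s) x y gʳˢ≈1 eq
  ... | Bézout.-+ x y eq = splitting-comm (bézout⇒splitting s (suc r) y x gˢʳ≈1 eq)
    where
    gˢʳ≈1 : g ^ (suc s ℕ.* suc r) ≈ 1#
    gˢʳ≈1 = ≡.subst (λ n → g ^ n ≈ 1#) (ℕ.*-comm (suc r) (suc s)) gʳˢ≈1

  -- Orbits of a matrix acting on F × F

  _≋_ : Vec2 F → Vec2 F → Set ℓ
  _≋_ = _≈v_ F

  private module ≋ = Setoid (×-setoid setoid setoid)

  _⊕_ : Vec2 F → Vec2 F → Vec2 F
  (x₁ , y₁) ⊕ (x₂ , y₂) = x₁ + x₂ , y₁ + y₂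

  ⊕-cong : ∀ {u u′ w w′} → u ≋ u′ → w ≋ w′ → (u ⊕ w) ≋ (u′ ⊕ w′)
  ⊕-cong (x≈ , y≈) (x′≈ , y′≈) = +-cong x≈ x′≈ , +-cong y≈ y′≈

  ·-cong : ∀ M {u w} → u ≋ w → _·_ F M u ≋ _·_ F M w
  ·-cong M (x≈ , y≈) = +-cong (*-cong refl x≈) (*-cong refl y≈) , +-cong (*-cong refl x≈) (*-cong refl y≈)

  ·-⊕ : ∀ M u w → _·_ F M (u ⊕ w) ≋ (_·_ F M u ⊕ _·_ F M w)
  ·-⊕ ((m₁₁ , m₁₂) , (m₂₁ , m₂₂)) (x₁ , y₁) (x₂ , y₂) = bilinear m₁₁ m₁₂ , bilinear m₂₁ m₂₂
    where
    bilinear : ∀ m n → m * (x₁ + x₂) + n * (y₁ + y₂) ≈ (m * x₁ + n * y₁) + (m * x₂ + n * y₂)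
    bilinear m n = solve 6 (λ m n x₁ x₂ y₁ y₂ →
      m :* (x₁ :+ x₂) :+ n :* (y₁ :+ y₂) := (m :* x₁ :+ n :* y₁) :+ (m :* x₂ :+ n :* y₂)) refl m n x₁ x₂ y₁ y₂

  powAct-cong : ∀ M n {u w} → u ≋ w → powAct F M n u ≋ powAct F M n w
  powAct-cong M zero    u≋w = u≋w
  powAct-cong M (suc n) u≋w = ·-cong M (powAct-cong M n u≋w)

  powAct-+ : ∀ M m n v → powAct F M (m ℕ.+ n) v ≡ powAct F M m (powAct F M n v)
  powAct-+ M zero    n v = ≡.refl
  powAct-+ M (suc m) n v = ≡.cong (_·_ F M) (powAct-+ M m n v)

  powAct-⊕ : ∀ M n u w → powAct F M n (u ⊕ w) ≋ (powAct F M n u ⊕ powAct F M n w)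
  powAct-⊕ M zero    u w = ≋.refl
  powAct-⊕ M (suc n) u w = ≋.trans (·-cong M (powAct-⊕ M n u w)) (·-⊕ M _ _)

  powAct-periodic : ∀ {M v N} → powAct F M N v ≋ v → ∀ q j → powAct F M (j ℕ.+ q ℕ.* N) v ≋ powAct F M j v
  powAct-periodic {M} {v} {N} Mᴺv≋v q j =
    ≡.subst (_≋ powAct F M j v) (≡.sym (powAct-+ M j (q ℕ.* N) v)) (powAct-cong M j (Mᵠᴺv≋v q))
    where
    Mᵠᴺv≋v : ∀ q → powAct F M (q ℕ.* N) v ≋ v
    Mᵠᴺv≋v zero    = ≋.refl
    Mᵠᴺv≋v (suc q) = ≡.subst (_≋ v) (≡.sym (powAct-+ M N (q ℕ.* N) v))
                       (≋.trans (powAct-cong M N (Mᵠᴺv≋v q)) Mᴺv≋v)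

  IsMinimalPeriod : Mat2 F → Vec2 F → ℕ → Set ℓ
  IsMinimalPeriod M v N = (1 ≤ N) × (powAct F M N v ≋ v) ×
    (∀ i d → 1 ≤ d → powAct F M i v ≋ powAct F M (d ℕ.+ i) v → N ≤ d)

  minimalPeriod⇒orbitLength : ∀ {M v N} → IsMinimalPeriod M v N → OrbitLength F M v N
  minimalPeriod⇒orbitLength {M} {v} {N} (1≤N , Mᴺv≋v , least) =
    applyUpTo point N , length-applyUpTo point N , AllPairs.applyUpTo⁺₁ point N distinct ,
    All.applyUpTo⁺₂ point N (λ j → j , ≋.refl) ,
    λ w (n , w≋Mⁿv) → Any.applyUpTo⁺ point (≋.trans w≋Mⁿv (reduce n)) (m%n<n n N)
    where
    instance
      N≢0 : ℕ.NonZero N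
      N≢0 = ℕ.>-nonZero 1≤N
    point : ℕ → Vec2 F
    point n = powAct F M n v
    distinct : ∀ {i j} → i < j → j < N → ¬ (point i ≋ point j)
    distinct {i} {j} i<j j<N Mⁱv≋Mʲv = ℕ.<⇒≱ (ℕ.≤-<-trans (ℕ.m∸n≤m j i) j<N)
      (least i (j ∸ i) (ℕ.m<n⇒0<n∸m i<j)
        (≡.subst (λ n → point i ≋ point n) (≡.sym (ℕ.m∸n+n≡m (ℕ.<⇒≤ i<j))) Mⁱv≋Mʲv))
    reduce : ∀ n → point n ≋ point (n % N)
    reduce n = ≡.subst (λ m → point m ≋ point (n % N)) (≡.sym (m≡m%n+[m/n]*n n N))
      (powAct-periodic Mᴺv≋v (n / N) (n % N))

  -- (x , 1#) is an eigenvector of Qmat a b, with eigenvalue x, exactly when IsRoot a b x.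
  IsRoot : Carrier → Carrier → Carrier → Set ℓ
  IsRoot a b x = a * x + b ≈ x * x

  vieta : ∀ {α β b} → α * β ≈ - b → IsRoot (α + β) b α × IsRoot (α + β) b β
  vieta {α} {β} {b} α*β≈-b =
    root α (solve 3 (λ α β b → (α :+ β) :* α :+ b := α :* α :+ (α :* β :+ b)) refl α β b) ,
    root β (solve 3 (λ α β b → (α :+ β) :* β :+ b := β :* β :+ (α :* β :+ b)) refl α β b)
    where
    root : ∀ x → (α + β) * x + b ≈ x * x + (α * β + b) → IsRoot (α + β) b x
    root x eq = trans eq (trans (+-cong refl (trans (+-cong α*β≈-b refl) (-‿inverseˡ b))) (+-identityʳ _))

  vandermonde-cancel : ∀ {x y A B A′ B′} → x ≉ y → A + B ≈ A′ + B′ →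
    x * A + y * B ≈ x * A′ + y * B′ → A ≈ A′ × B ≈ B′
  vandermonde-cancel {x} {y} {A} {B} {A′} {B′} x≉y A+B≈A′+B′ xA+yB≈xA′+yB′ =
    A≈A′ , +-cancelˡ A B B′ (trans A+B≈A′+B′ (+-cong (sym A≈A′) refl))
    where
    δ+y≈x : (x - y) + y ≈ x
    δ+y≈x = trans (+-assoc x (- y) y) (trans (+-cong refl (-‿inverseˡ y)) (+-identityʳ x))
    regroup : ∀ A B → x * A + y * B ≈ (x - y) * A + y * (A + B)
    regroup A B = trans (+-cong (*-cong (sym δ+y≈x) refl) refl)
      (solve 4 (λ δ y A B → (δ :+ y) :* A :+ y :* B := δ :* A :+ y :* (A :+ B)) refl (x - y) y A B)
    A≈A′ : A ≈ A′
    A≈A′ = *-cancelˡ-≉0 (λ δ≈0 → x≉y (x∙y⁻¹≈ε⇒x≈y x y δ≈0)) (+-cancelʳ (y * (A + B)) _ _ (begin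
      (x - y) * A + y * (A + B)    ≈⟨ regroup A B ⟨
      x * A + y * B                ≈⟨ xA+yB≈xA′+yB′ ⟩
      x * A′ + y * B′              ≈⟨ regroup A′ B′ ⟩
      (x - y) * A′ + y * (A′ + B′) ≈⟨ +-cong refl (*-cong refl A+B≈A′+B′) ⟨
      (x - y) * A′ + y * (A + B)   ∎))

  record CoprimeRootPair (b : Carrier) (r s : ℕ) : Set (c ⊔ ℓ) where
    field
      α β         : Carrier
      α-root      : IsRoot (α + β) b α
      β-root      : IsRoot (α + β) b β
      α-order     : IsMultOrder F α r
      β-order     : IsMultOrder F β s
      joint-order : IsJointOrder α β (r ℕ.* s)
      α≉β         : α ≉ β
      α+β≉0       : α + β ≉ 0#

  coprimeRootPair : ∀ {b k} → IsMultOrder F (- b) k → (φ : CoprimeFactorisation k) →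
    CoprimeRootPair b (CoprimeFactorisation.r φ) (CoprimeFactorisation.s φ)
  coprimeRootPair {b} ord φ = record
    { α           = α
    ; β           = β
    ; α-root      = proj₁ (vieta α*β≈g)
    ; β-root      = proj₂ (vieta α*β≈g)
    ; α-order     = α-order
    ; β-order     = β-order
    ; joint-order = joint
    ; α≉β         = λ α≈β → r≢s (isMultOrder-unique α≈β α-order β-order)
    ; α+β≉0       = jointOrder-sum≉0 joint αʳ≈1 βˢ≈1 2≤r 2≤s r≢s
    }
    where
    open CoprimeFactorisation φ
    ordᵍ : IsMultOrder F (- b) (r ℕ.* s)
    ordᵍ = ≡.subst (IsMultOrder F (- b)) (≡.sym r*s≡k) ord
    σ : Splitting (- b) r s
    σ = coprime⇒splitting (proj₁ (proj₂ ordᵍ)) 1≤r 1≤s coprime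
    open Splitting σ
    joint : IsJointOrder α β (r ℕ.* s)
    joint = splitting⇒isJointOrder ordᵍ σ
    α-order : IsMultOrder F α r
    α-order = isJointOrder⇒isMultOrder joint 1≤r 1≤s αʳ≈1 βˢ≈1
    β-order : IsMultOrder F β s
    β-order = isJointOrder⇒isMultOrder (isJointOrder-comm r s joint) 1≤s 1≤r βˢ≈1 αʳ≈1

  module Companion (a b : Carrier) where

    Q : Mat2 F
    Q = Qmat F a b

    powAct-root : ∀ {x} → IsRoot a b x → ∀ n → powAct F Q n (x , 1#) ≋ (x * x ^ n , x ^ n)
    powAct-root {x} root zero    = sym (*-identityʳ x) , refl
    powAct-root {x} root (suc n) = ≋.trans (·-cong Q (powAct-root root n)) (first , second)
      where
      first : a * (x * x ^ n) + b * x ^ n ≈ x * (x * x ^ n)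
      first = begin
        a * (x * x ^ n) + b * x ^ n  ≈⟨ solve 4 (λ a x p b → a :* (x :* p) :+ b :* p := (a :* x :+ b) :* p)
                                          refl a x (x ^ n) b ⟩
        (a * x + b) * x ^ n          ≈⟨ *-cong root refl ⟩
        (x * x) * x ^ n              ≈⟨ *-assoc x x (x ^ n) ⟩
        x * (x * x ^ n)              ∎
      second : 1# * (x * x ^ n) + 0# * x ^ n ≈ x * x ^ n
      second = trans (+-cong (*-identityˡ _) (zeroˡ _)) (+-identityʳ _)

    rootVector-periodic : ∀ {x} N → x ^ N ≈ 1# → (x * x ^ N , x ^ N) ≋ (x , 1#)
    rootVector-periodic {x} N xᴺ≈1 = trans (*-cong refl xᴺ≈1) (*-identityʳ x) , xᴺ≈1

    root-minimalPeriod : ∀ {x N} → IsRoot a b x → IsMultOrder F x N → IsMinimalPeriod Q (x , 1#) N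
    root-minimalPeriod {x} {N} root (1≤N , xᴺ≈1 , least) =
      1≤N , ≋.trans (powAct-root root N) (rootVector-periodic N xᴺ≈1) , λ i d 1≤d Qⁱv≋Qᵈ⁺ⁱv →
        least d 1≤d (x^i≈x^[d+i]⇒x^d≈1 i d (x^n≈1⇒x≉0 N 1≤N xᴺ≈1)
          (proj₂ (≋.trans (≋.sym (powAct-root root i)) (≋.trans Qⁱv≋Qᵈ⁺ⁱv (powAct-root root (d ℕ.+ i))))))

    rootPair-minimalPeriod : ∀ {x y N} → IsRoot a b x → IsRoot a b y → x ≉ y → IsJointOrder x y N →
      IsMinimalPeriod Q ((x , 1#) ⊕ (y , 1#)) N
    rootPair-minimalPeriod {x} {y} {N} x-root y-root x≉y (1≤N , xᴺ≈1 , yᴺ≈1 , least) =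
      1≤N , ≋.trans (orbit N) (⊕-cong (rootVector-periodic N xᴺ≈1) (rootVector-periodic N yᴺ≈1)) ,
      λ i d 1≤d Qⁱv≋Qᵈ⁺ⁱv →
        let eq = ≋.trans (≋.sym (orbit i)) (≋.trans Qⁱv≋Qᵈ⁺ⁱv (orbit (d ℕ.+ i)))
            xⁱ≈xᵈ⁺ⁱ , yⁱ≈yᵈ⁺ⁱ = vandermonde-cancel x≉y (proj₂ eq) (proj₁ eq)
        in least d 1≤d (x^i≈x^[d+i]⇒x^d≈1 i d (x^n≈1⇒x≉0 N 1≤N xᴺ≈1) xⁱ≈xᵈ⁺ⁱ)
                       (x^i≈x^[d+i]⇒x^d≈1 i d (x^n≈1⇒x≉0 N 1≤N yᴺ≈1) yⁱ≈yᵈ⁺ⁱ)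
      where
      orbit : ∀ n → powAct F Q n ((x , 1#) ⊕ (y , 1#)) ≋ ((x * x ^ n , x ^ n) ⊕ (y * y ^ n , y ^ n))
      orbit n = ≋.trans (powAct-⊕ Q n _ _) (⊕-cong (powAct-root x-root n) (powAct-root y-root n))

mainTheorem12 : ∀ {c ℓ} (F : FiniteField c ℓ) → let open FiniteField F in
    ∀ (b : Carrier) (k : ℕ) → b ≉ 0# → IsMultOrder F (- b) k → ¬ IsPrimePower k →
    ∃[ a ] ((a ≉ 0#) ×
      ∃[ v₁ ] ∃[ v₂ ] ∃[ v₃ ] ∃[ m₁ ] ∃[ m₂ ] ∃[ m₃ ]
        ((¬ (_≈v_ F v₁ (zeroV F))) × (¬ (_≈v_ F v₂ (zeroV F))) × (¬ (_≈v_ F v₃ (zeroV F)))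
        × OrbitLength F (Qmat F a b) v₁ m₁
        × OrbitLength F (Qmat F a b) v₂ m₂
        × OrbitLength F (Qmat F a b) v₃ m₃
        × (m₁ ≢ m₂) × (m₁ ≢ m₃) × (m₂ ≢ m₃)))
mainTheorem12 F b k _ ord ¬pp =
  α + β , α+β≉0 , (α , 1#) , (β , 1#) , (α , 1#) ⊕ (β , 1#) , r , s , r ℕ.* s ,
  (λ (_ , 1≈0) → 0≉1 (sym 1≈0)) , (λ (_ , 1≈0) → 0≉1 (sym 1≈0)) , (λ (α+β≈0 , _) → α+β≉0 α+β≈0) ,
  minimalPeriod⇒orbitLength (root-minimalPeriod α-root α-order) ,
  minimalPeriod⇒orbitLength (root-minimalPeriod β-root β-order) ,
  minimalPeriod⇒orbitLength (rootPair-minimalPeriod α-root β-root α≉β joint-order) ,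
  r≢s , r≢r*s , s≢r*s
  where
  open FiniteField F
  open Properties F
  factorisation : CoprimeFactorisation k
  factorisation = ¬primePower⇒coprimeFactorisation (proj₁ ord) ¬pp
  open CoprimeFactorisation factorisation
  open CoprimeRootPair (coprimeRootPair ord factorisation)
  open Companion (α + β) b
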